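{- Let $\Sigma$ be a finite bipartite graph with bipartition $P\cup R$, and let $U\subseteq R$. Let $K\cup L\cup M$ be a legal cover (with respect to $U$) for which $|K\cup L|$ is as small as possible among all legal covers. Then (a) for every $K'\subseteq K$, $|N(K')\cap(U\setminus L)|\ge|K'|$; (b) for every $L'\subseteq L$, $|N(L')\setminus K|\ge|L'|$.
   Context: A (vertex) cover of $\Sigma$ is a set of vertices containing at least one endpoint of every edge; it is minimal if no proper subset is a cover. $N(X)$ denotes the set of vertices adjacent to some vertex of $X$. A cover $K\cup L\cup M$ with $K\subseteq P$, $L\subseteq U$, $M\subseteq R\setminus U$ is legal (with respect to $U$) if it is a minimal cover and $K=N(U\setminus L)$. -}

module Defs where

open import Data.Nat using (ℕ; _+_)
open import Data.Bool using (Bool; true; false; _∧_; _∨_)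
open import Data.Fin using (Fin; zero; suc)
open import Data.Fin.Subset using (Subset; _⊆_; _∩_; _∪_; ∁; ∣_∣; _∈_)
open import Data.Vec using (tabulate; lookup)
open import Data.Product using (_×_)
open import Relation.Binary.PropositionalEquality using (_≡_)

-- A finite bipartite graph Σ with bipartition P ∪ R, P = Fin p, R = Fin r,
-- given by its (Boolean) adjacency relation: adj i j = true iff i ∈ P and
-- j ∈ R are joined by an edge.
BipGraph : ℕ → ℕ → Set
BipGraph p r = Fin p → Fin r → Bool

anyFin : ∀ {n} → (Fin n → Bool) → Bool
anyFin {ℕ.zero}  f = false
anyFin {ℕ.suc n} f = f zero ∨ anyFin (λ i → f (suc i))

module _ {p r : ℕ} (Σ : BipGraph p r) where

  NR : Subset r → Subset p
  NR X = tabulate λ i → anyFin λ j → lookup X j ∧ Σ i j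

  NP : Subset p → Subset r
  NP X = tabulate λ j → anyFin λ i → lookup X i ∧ Σ i j

  IsCover : Subset p → Subset r → Set
  IsCover A B = ∀ i j → Σ i j ≡ true → (i ∈ A) Data.Sum.⊎ (j ∈ B)
    where import Data.Sum

  IsMinimalCover : Subset p → Subset r → Set
  IsMinimalCover A B =
    IsCover A B ×
    (∀ A' B' → A' ⊆ A → B' ⊆ B → IsCover A' B' → (A' ≡ A) × (B' ≡ B))

  IsLegal : (U : Subset r) → Subset p → Subset r → Subset r → Set
  IsLegal U K L M =
    (L ⊆ U) × (M ⊆ ∁ U) ×
    IsMinimalCover K (L ∪ M) ×
    (K ≡ NR (U ∩ ∁ L))

-- Every X ⊆ R yields a legal cover: let L be the vertices of U having a neighbour
-- outside N(X), K = N(U ∖ L), which lies inside N(X), and M the vertices of R ∖ U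
-- adjacent to P ∖ K.  It is minimal because each of its vertices has a neighbour
-- outside it, and |K| + |L| ≤ |N(X)| + |U ∖ X|.  So an optimal legal cover obeys
-- |K| + |L| ≤ |N(X)| + |U ∖ X| for every X.  Part (a) follows with
-- X = (U ∖ L) ∖ N(K'), whose neighbourhood lies in K ∖ K', and part (b) with
-- X = (U ∖ L) ∪ L', whose neighbourhood lies in K ∪ (N(L') ∖ K).
module Submission where

open import Defs
open import Data.Nat using (ℕ; zero; suc; _+_; _≤_)
open import Data.Nat.Properties
  using ( +-suc; +-assoc; m≤n+m; ≤-trans; +-mono-≤; +-monoˡ-≤; +-monoʳ-≤; +-cancelˡ-≤
        ; +-commutativeSemigroup; module ≤-Reasoning)
open import Algebra.Properties.CommutativeSemigroup +-commutativeSemigroup using (xy∙z≈xz∙y)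
open import Data.Bool using (Bool; true; false; _∧_; _∨_)
open import Data.Bool.Properties using (∨-zeroʳ; ∧-conicalˡ; ∧-conicalʳ)
open import Data.Fin using (Fin) renaming (zero to fzero; suc to fsuc)
open import Data.Fin.Subset using (Subset; _⊆_; _∩_; _∪_; ∁; ∣_∣; _∈_; _∉_; Empty)
open import Data.Fin.Subset.Properties
  using ( _∈?_; ⊆-antisym; Empty-unique; ∣⊥∣≡0; p⊆q⇒∣p∣≤∣q∣
        ; p∩q⊆p; p∩q⊆q; x∈p∩q⁺; x∈p∩q⁻; x∈p∪q⁺; x∈p∪q⁻
        ; x∈∁p⇒x∉p; x∉∁p⇒x∈p; x∉p⇒x∈∁p)
open import Data.Vec using ([]; _∷_; lookup; tabulate)
open import Data.Vec.Properties using (lookup∘tabulate; []=⇒lookup; lookup⇒[]=)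
open import Data.Product using (_×_; _,_; ∃; proj₁; proj₂)
open import Data.Sum using (inj₁; inj₂)
open import Relation.Nullary using (yes; no; contradiction)
open import Relation.Binary.PropositionalEquality using (_≡_; refl; sym; trans; cong; cong₂; subst)

∣p∩q∣+∣p∪q∣≡∣p∣+∣q∣ : ∀ {n} (p q : Subset n) → ∣ p ∩ q ∣ + ∣ p ∪ q ∣ ≡ ∣ p ∣ + ∣ q ∣
∣p∩q∣+∣p∪q∣≡∣p∣+∣q∣ []          []          = refl
∣p∩q∣+∣p∪q∣≡∣p∣+∣q∣ (true ∷ p)  (true ∷ q)  =
  cong suc (trans (+-suc _ _) (trans (cong suc (∣p∩q∣+∣p∪q∣≡∣p∣+∣q∣ p q)) (sym (+-suc _ _))))
∣p∩q∣+∣p∪q∣≡∣p∣+∣q∣ (true ∷ p)  (false ∷ q) = trans (+-suc _ _) (cong suc (∣p∩q∣+∣p∪q∣≡∣p∣+∣q∣ p q))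
∣p∩q∣+∣p∪q∣≡∣p∣+∣q∣ (false ∷ p) (true ∷ q)  =
  trans (+-suc _ _) (trans (cong suc (∣p∩q∣+∣p∪q∣≡∣p∣+∣q∣ p q)) (sym (+-suc _ _)))
∣p∩q∣+∣p∪q∣≡∣p∣+∣q∣ (false ∷ p) (false ∷ q) = ∣p∩q∣+∣p∪q∣≡∣p∣+∣q∣ p q

∣p∪q∣≤∣p∣+∣q∣ : ∀ {n} (p q : Subset n) → ∣ p ∪ q ∣ ≤ ∣ p ∣ + ∣ q ∣
∣p∪q∣≤∣p∣+∣q∣ p q = subst (∣ p ∪ q ∣ ≤_) (∣p∩q∣+∣p∪q∣≡∣p∣+∣q∣ p q) (m≤n+m _ _)

Disjoint : ∀ {n} → Subset n → Subset n → Set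
Disjoint p q = Empty (p ∩ q)

∣p∪q∣≡∣p∣+∣q∣ : ∀ {n} {p q : Subset n} → Disjoint p q → ∣ p ∪ q ∣ ≡ ∣ p ∣ + ∣ q ∣
∣p∪q∣≡∣p∣+∣q∣ {n} {p} {q} p#q = begin
  ∣ p ∪ q ∣               ≡⟨ cong (_+ ∣ p ∪ q ∣) (sym ∣p∩q∣≡0) ⟩
  ∣ p ∩ q ∣ + ∣ p ∪ q ∣   ≡⟨ ∣p∩q∣+∣p∪q∣≡∣p∣+∣q∣ p q ⟩
  ∣ p ∣ + ∣ q ∣           ∎
  where
  open Relation.Binary.PropositionalEquality.≡-Reasoning
  ∣p∩q∣≡0 : ∣ p ∩ q ∣ ≡ 0
  ∣p∩q∣≡0 = trans (cong ∣_∣ (Empty-unique p#q)) (∣⊥∣≡0 n)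

Disjoint⇒∣p∣+∣q∣≤∣s∣ : ∀ {n} {p q s : Subset n} →
  Disjoint p q → p ∪ q ⊆ s → ∣ p ∣ + ∣ q ∣ ≤ ∣ s ∣
Disjoint⇒∣p∣+∣q∣≤∣s∣ p#q p∪q⊆s = subst (_≤ _) (∣p∪q∣≡∣p∣+∣q∣ p#q) (p⊆q⇒∣p∣≤∣q∣ p∪q⊆s)

anyFin⁺ : ∀ {n} (f : Fin n → Bool) i → f i ≡ true → anyFin f ≡ true
anyFin⁺ f fzero    fi = cong (_∨ anyFin (λ k → f (fsuc k))) fi
anyFin⁺ f (fsuc i) fi =
  trans (cong (f fzero ∨_) (anyFin⁺ (λ k → f (fsuc k)) i fi)) (∨-zeroʳ (f fzero))

anyFin⁻ : ∀ {n} (f : Fin n → Bool) → anyFin f ≡ true → ∃ λ i → f i ≡ true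
anyFin⁻ {zero}  f ()
anyFin⁻ {suc n} f any with f fzero in f0
... | true  = fzero , f0
... | false with anyFin⁻ (λ k → f (fsuc k)) any
...   | i , fi = fsuc i , fi

∈-tabulate⁺ : ∀ {n} {f : Fin n → Bool} {i} → f i ≡ true → i ∈ tabulate f
∈-tabulate⁺ {f = f} {i} fi = lookup⇒[]= i (tabulate f) (trans (lookup∘tabulate f i) fi)

∈-tabulate⁻ : ∀ {n} {f : Fin n → Bool} {i} → i ∈ tabulate f → f i ≡ true
∈-tabulate⁻ {f = f} {i} i∈ = trans (sym (lookup∘tabulate f i)) ([]=⇒lookup i∈)

module _ {p r : ℕ} (Σ : BipGraph p r) where

  Edge : Fin p → Fin r → Set
  Edge i j = Σ i j ≡ true

  ∈NR⁺ : ∀ {X i j} → j ∈ X → Edge i j → i ∈ NR Σ X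
  ∈NR⁺ {X} {i} {j} j∈X ij = ∈-tabulate⁺ (anyFin⁺ _ j (cong₂ _∧_ ([]=⇒lookup j∈X) ij))

  ∈NR⁻ : ∀ {X i} → i ∈ NR Σ X → ∃ λ j → j ∈ X × Edge i j
  ∈NR⁻ {X} {i} i∈N with anyFin⁻ _ (∈-tabulate⁻ i∈N)
  ... | j , Xj∧ij = j , lookup⇒[]= j X (∧-conicalˡ _ _ Xj∧ij) , ∧-conicalʳ _ _ Xj∧ij

  ∈NP⁺ : ∀ {X i j} → i ∈ X → Edge i j → j ∈ NP Σ X
  ∈NP⁺ {X} {i} {j} i∈X ij = ∈-tabulate⁺ (anyFin⁺ _ i (cong₂ _∧_ ([]=⇒lookup i∈X) ij))

  ∈NP⁻ : ∀ {X j} → j ∈ NP Σ X → ∃ λ i → i ∈ X × Edge i j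
  ∈NP⁻ {X} {j} j∈N with anyFin⁻ _ (∈-tabulate⁻ j∈N)
  ... | i , Xi∧ij = i , lookup⇒[]= i X (∧-conicalˡ _ _ Xi∧ij) , ∧-conicalʳ _ _ Xi∧ij

  uncovered-neighbours⇒minimal : ∀ {A B} → IsCover Σ A B →
    (∀ {i} → i ∈ A → ∃ λ j → j ∉ B × Edge i j) →
    (∀ {j} → j ∈ B → ∃ λ i → i ∉ A × Edge i j) →
    IsMinimalCover Σ A B
  uncovered-neighbours⇒minimal {A} {B} cover A-witness B-witness =
    cover , λ A' B' A'⊆A B'⊆B cover' →
      ⊆-antisym A'⊆A (A⊆A' cover' B'⊆B) , ⊆-antisym B'⊆B (B⊆B' cover' A'⊆A)
    where
    A⊆A' : ∀ {A' B'} → IsCover Σ A' B' → B' ⊆ B → A ⊆ A'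
    A⊆A' cover' B'⊆B i∈A with A-witness i∈A
    ... | j , j∉B , ij with cover' _ _ ij
    ...   | inj₁ i∈A' = i∈A'
    ...   | inj₂ j∈B' = contradiction (B'⊆B j∈B') j∉B
    B⊆B' : ∀ {A' B'} → IsCover Σ A' B' → A' ⊆ A → B ⊆ B'
    B⊆B' cover' A'⊆A j∈B with B-witness j∈B
    ... | i , i∉A , ij with cover' _ _ ij
    ...   | inj₁ i∈A' = contradiction (A'⊆A i∈A') i∉A
    ...   | inj₂ j∈B' = j∈B'

  module LegalCoverFrom (U X : Subset r) where

    L : Subset r
    L = U ∩ NP Σ (∁ (NR Σ X))

    K : Subset p
    K = NR Σ (U ∩ ∁ L)

    M : Subset r
    M = NP Σ (∁ K) ∩ ∁ U

    K⊆N[X] : K ⊆ NR Σ X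
    K⊆N[X] {i} i∈K with ∈NR⁻ i∈K
    ... | j , j∈U∖L , ij with x∈p∩q⁻ U (∁ L) j∈U∖L
    ...   | j∈U , j∈∁L = x∉∁p⇒x∈p λ i∈∁NX → x∈∁p⇒x∉p j∈∁L (x∈p∩q⁺ (j∈U , ∈NP⁺ i∈∁NX ij))

    L⊆U∖X : L ⊆ U ∩ ∁ X
    L⊆U∖X j∈L with x∈p∩q⁻ U _ j∈L
    ... | j∈U , j∈N[∁NX] with ∈NP⁻ j∈N[∁NX]
    ...   | i , i∈∁NX , ij = x∈p∩q⁺ (j∈U , x∉p⇒x∈∁p λ j∈X → x∈∁p⇒x∉p i∈∁NX (∈NR⁺ j∈X ij))

    cover : IsCover Σ K (L ∪ M)
    cover i j ij with i ∈? K
    ... | yes i∈K = inj₁ i∈K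
    ... | no  i∉K with j ∈? U
    ...   | no  j∉U = inj₂ (x∈p∪q⁺ (inj₂ (x∈p∩q⁺ (∈NP⁺ (x∉p⇒x∈∁p i∉K) ij , x∉p⇒x∈∁p j∉U))))
    ...   | yes j∈U with j ∈? L
    ...     | yes j∈L = inj₂ (x∈p∪q⁺ (inj₁ j∈L))
    ...     | no  j∉L = contradiction (∈NR⁺ (x∈p∩q⁺ (j∈U , x∉p⇒x∈∁p j∉L)) ij) i∉K

    K-witness : ∀ {i} → i ∈ K → ∃ λ j → j ∉ L ∪ M × Edge i j
    K-witness i∈K with ∈NR⁻ i∈K
    ... | j , j∈U∖L , ij with x∈p∩q⁻ U (∁ L) j∈U∖L
    ...   | j∈U , j∈∁L = j , j∉L∪M , ij
      where
      j∉L∪M : _ ∉ L ∪ M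
      j∉L∪M j∈L∪M with x∈p∪q⁻ L M j∈L∪M
      ... | inj₁ j∈L = x∈∁p⇒x∉p j∈∁L j∈L
      ... | inj₂ j∈M = x∈∁p⇒x∉p (proj₂ (x∈p∩q⁻ _ (∁ U) j∈M)) j∈U

    L∪M-witness : ∀ {j} → j ∈ L ∪ M → ∃ λ i → i ∉ K × Edge i j
    L∪M-witness j∈L∪M with x∈p∪q⁻ L M j∈L∪M
    ... | inj₁ j∈L with ∈NP⁻ (proj₂ (x∈p∩q⁻ U _ j∈L))
    ...   | i , i∈∁NX , ij = i , (λ i∈K → x∈∁p⇒x∉p i∈∁NX (K⊆N[X] i∈K)) , ij
    L∪M-witness _ | inj₂ j∈M with ∈NP⁻ (proj₁ (x∈p∩q⁻ _ (∁ U) j∈M))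
    ...   | i , i∈∁K , ij = i , x∈∁p⇒x∉p i∈∁K , ij

    legal : IsLegal Σ U K L M
    legal = p∩q⊆p U _ , p∩q⊆q _ (∁ U)
          , uncovered-neighbours⇒minimal cover K-witness L∪M-witness , refl

    cost : ∣ K ∣ + ∣ L ∣ ≤ ∣ NR Σ X ∣ + ∣ U ∩ ∁ X ∣
    cost = +-mono-≤ (p⊆q⇒∣p∣≤∣q∣ K⊆N[X]) (p⊆q⇒∣p∣≤∣q∣ L⊆U∖X)

  BelowEveryCost : Subset r → Subset p → Subset r → Set
  BelowEveryCost U K L = ∀ X → ∣ K ∣ + ∣ L ∣ ≤ ∣ NR Σ X ∣ + ∣ U ∩ ∁ X ∣

  optimal⇒BelowEveryCost : ∀ U K L →
    (∀ K₂ L₂ M₂ → IsLegal Σ U K₂ L₂ M₂ → ∣ K ∣ + ∣ L ∣ ≤ ∣ K₂ ∣ + ∣ L₂ ∣) →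
    BelowEveryCost U K L
  optimal⇒BelowEveryCost U K L optimal X =
    ≤-trans (optimal C.K C.L C.M C.legal) C.cost
    where module C = LegalCoverFrom U X

  hall-K : ∀ U K L → K ≡ NR Σ (U ∩ ∁ L) → BelowEveryCost U K L →
    ∀ K' → K' ⊆ K → ∣ K' ∣ ≤ ∣ NP Σ K' ∩ (U ∩ ∁ L) ∣
  hall-K U K L K≡N[U∖L] below K' K'⊆K = +-cancelˡ-≤ (∣ NR Σ X ∣ + ∣ L ∣) (∣ K' ∣) (∣ C ∣) (begin
    (∣ NR Σ X ∣ + ∣ L ∣) + ∣ K' ∣  ≡⟨ xy∙z≈xz∙y (∣ NR Σ X ∣) (∣ L ∣) (∣ K' ∣) ⟩
    (∣ NR Σ X ∣ + ∣ K' ∣) + ∣ L ∣  ≤⟨ +-monoˡ-≤ _ (Disjoint⇒∣p∣+∣q∣≤∣s∣ N[X]#K' N[X]∪K'⊆K) ⟩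
    ∣ K ∣ + ∣ L ∣                  ≤⟨ below X ⟩
    ∣ NR Σ X ∣ + ∣ U ∩ ∁ X ∣       ≤⟨ +-monoʳ-≤ _ ∣U∖X∣≤∣L∣+∣C∣ ⟩
    ∣ NR Σ X ∣ + (∣ L ∣ + ∣ C ∣)   ≡⟨ +-assoc (∣ NR Σ X ∣) (∣ L ∣) (∣ C ∣) ⟨
    (∣ NR Σ X ∣ + ∣ L ∣) + ∣ C ∣   ∎)
    where
    open ≤-Reasoning
    X : Subset r
    X = (U ∩ ∁ L) ∩ ∁ (NP Σ K')
    C : Subset r
    C = NP Σ K' ∩ (U ∩ ∁ L)

    N[X]#K' : Disjoint (NR Σ X) K'
    N[X]#K' (i , i∈N[X]∩K') with x∈p∩q⁻ (NR Σ X) K' i∈N[X]∩K'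
    ... | i∈N[X] , i∈K' with ∈NR⁻ i∈N[X]
    ...   | j , j∈X , ij = x∈∁p⇒x∉p (p∩q⊆q (U ∩ ∁ L) _ j∈X) (∈NP⁺ i∈K' ij)

    N[X]∪K'⊆K : NR Σ X ∪ K' ⊆ K
    N[X]∪K'⊆K {i} i∈N[X]∪K' with x∈p∪q⁻ (NR Σ X) K' i∈N[X]∪K'
    ... | inj₂ i∈K' = K'⊆K i∈K'
    ... | inj₁ i∈N[X] with ∈NR⁻ i∈N[X]
    ...   | j , j∈X , ij = subst (i ∈_) (sym K≡N[U∖L]) (∈NR⁺ (p∩q⊆p (U ∩ ∁ L) _ j∈X) ij)

    U∖X⊆L∪C : U ∩ ∁ X ⊆ L ∪ C
    U∖X⊆L∪C {j} j∈U∖X with x∈p∩q⁻ U (∁ X) j∈U∖X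
    ... | j∈U , j∈∁X with j ∈? L
    ...   | yes j∈L = x∈p∪q⁺ (inj₁ j∈L)
    ...   | no  j∉L with j ∈? NP Σ K'
    ...     | yes j∈N[K'] = x∈p∪q⁺ (inj₂ (x∈p∩q⁺ (j∈N[K'] , j∈U∖L)))
      where j∈U∖L = x∈p∩q⁺ (j∈U , x∉p⇒x∈∁p j∉L)
    ...     | no  j∉N[K'] =
      contradiction (x∈p∩q⁺ (x∈p∩q⁺ (j∈U , x∉p⇒x∈∁p j∉L) , x∉p⇒x∈∁p j∉N[K'])) (x∈∁p⇒x∉p j∈∁X)

    ∣U∖X∣≤∣L∣+∣C∣ : ∣ U ∩ ∁ X ∣ ≤ ∣ L ∣ + ∣ C ∣
    ∣U∖X∣≤∣L∣+∣C∣ = ≤-trans (p⊆q⇒∣p∣≤∣q∣ U∖X⊆L∪C) (∣p∪q∣≤∣p∣+∣q∣ L C)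

  hall-L : ∀ U K L → K ≡ NR Σ (U ∩ ∁ L) → BelowEveryCost U K L →
    ∀ L' → L' ⊆ L → ∣ L' ∣ ≤ ∣ NR Σ L' ∩ ∁ K ∣
  hall-L U K L K≡N[U∖L] below L' L'⊆L = +-cancelˡ-≤ (∣ K ∣ + ∣ L ∣) (∣ L' ∣) (∣ C ∣) (begin
    (∣ K ∣ + ∣ L ∣) + ∣ L' ∣              ≤⟨ +-monoˡ-≤ (∣ L' ∣) (below X) ⟩
    (∣ NR Σ X ∣ + ∣ U ∩ ∁ X ∣) + ∣ L' ∣   ≡⟨ +-assoc (∣ NR Σ X ∣) (∣ U ∩ ∁ X ∣) (∣ L' ∣) ⟩
    ∣ NR Σ X ∣ + (∣ U ∩ ∁ X ∣ + ∣ L' ∣)   ≤⟨ +-mono-≤ ∣N[X]∣≤∣K∣+∣C∣ ∣U∖X∣+∣L'∣≤∣L∣ ⟩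
    (∣ K ∣ + ∣ C ∣) + ∣ L ∣               ≡⟨ xy∙z≈xz∙y (∣ K ∣) (∣ C ∣) (∣ L ∣) ⟩
    (∣ K ∣ + ∣ L ∣) + ∣ C ∣               ∎)
    where
    open ≤-Reasoning
    X : Subset r
    X = (U ∩ ∁ L) ∪ L'
    C : Subset p
    C = NR Σ L' ∩ ∁ K

    N[X]⊆K∪C : NR Σ X ⊆ K ∪ C
    N[X]⊆K∪C {i} i∈N[X] with i ∈? K
    ... | yes i∈K = x∈p∪q⁺ (inj₁ i∈K)
    ... | no  i∉K with ∈NR⁻ i∈N[X]
    ...   | j , j∈X , ij with x∈p∪q⁻ (U ∩ ∁ L) L' j∈X
    ...     | inj₁ j∈U∖L = contradiction (subst (i ∈_) (sym K≡N[U∖L]) (∈NR⁺ j∈U∖L ij)) i∉K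
    ...     | inj₂ j∈L'  = x∈p∪q⁺ (inj₂ (x∈p∩q⁺ (∈NR⁺ j∈L' ij , x∉p⇒x∈∁p i∉K)))

    ∣N[X]∣≤∣K∣+∣C∣ : ∣ NR Σ X ∣ ≤ ∣ K ∣ + ∣ C ∣
    ∣N[X]∣≤∣K∣+∣C∣ = ≤-trans (p⊆q⇒∣p∣≤∣q∣ N[X]⊆K∪C) (∣p∪q∣≤∣p∣+∣q∣ K C)

    U∖X#L' : Disjoint (U ∩ ∁ X) L'
    U∖X#L' (j , j∈U∖X∩L') with x∈p∩q⁻ (U ∩ ∁ X) L' j∈U∖X∩L'
    ... | j∈U∖X , j∈L' = x∈∁p⇒x∉p (p∩q⊆q _ _ j∈U∖X) (x∈p∪q⁺ (inj₂ j∈L'))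

    U∖X∪L'⊆L : (U ∩ ∁ X) ∪ L' ⊆ L
    U∖X∪L'⊆L j∈U∖X∪L' with x∈p∪q⁻ (U ∩ ∁ X) L' j∈U∖X∪L'
    ... | inj₂ j∈L' = L'⊆L j∈L'
    ... | inj₁ j∈U∖X with x∈p∩q⁻ U (∁ X) j∈U∖X
    ...   | j∈U , j∈∁X = x∉∁p⇒x∈p λ j∈∁L → x∈∁p⇒x∉p j∈∁X (x∈p∪q⁺ (inj₁ (x∈p∩q⁺ (j∈U , j∈∁L))))

    ∣U∖X∣+∣L'∣≤∣L∣ : ∣ U ∩ ∁ X ∣ + ∣ L' ∣ ≤ ∣ L ∣
    ∣U∖X∣+∣L'∣≤∣L∣ = Disjoint⇒∣p∣+∣q∣≤∣s∣ U∖X#L' U∖X∪L'⊆L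

lemma2p19 : {p r : ℕ} (Σ : BipGraph p r) (U : Subset r)
    (K : Subset p) (L M : Subset r) →
    IsLegal Σ U K L M →
    (∀ (K₂ : Subset p) (L₂ M₂ : Subset r) → IsLegal Σ U K₂ L₂ M₂ →
      ∣ K ∣ + ∣ L ∣ ≤ ∣ K₂ ∣ + ∣ L₂ ∣) →
    (∀ (K' : Subset p) → K' ⊆ K → ∣ K' ∣ ≤ ∣ NP Σ K' ∩ (U ∩ ∁ L) ∣)
    × (∀ (L' : Subset r) → L' ⊆ L → ∣ L' ∣ ≤ ∣ NR Σ L' ∩ ∁ K ∣)
lemma2p19 Σ U K L M (_ , _ , _ , K≡N[U∖L]) optimal =
  hall-K Σ U K L K≡N[U∖L] below , hall-L Σ U K L K≡N[U∖L] below
  where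
  below : BelowEveryCost Σ U K L
  below = optimal⇒BelowEveryCost Σ U K L optimal
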